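{- The statistics wexx and cdes on permutations each exhibit the cyclic sieving phenomenon with respect to involutions that have $1$ fixed point when $n=0$ and $2^{n-1}$ fixed points when $n\ge1$.
   Context: $\mathfrak{S}_n$ is the set of permutations of $[n]$. $\mathrm{wexx}(\sigma)$ is the number of $j$ with $j\le\sigma(j)$ such that there exist $i<j<k$ with $\sigma(i)>\sigma(j)>\sigma(k)$. $\mathrm{cdes}(\sigma)$ is the number of $i$ with $i>\sigma(i)$ such that $\sigma(i)$ is not the smallest element of its cycle. Cyclic sieving for involutions: for an involution $\phi$ on a finite set $X$ and polynomial $f$, $(X,\{\mathrm{id},\phi\},f)$ exhibits the CSP iff $f(1)=|X|$ and $f(-1)$ equals the number of fixed points of $\phi$. A statistic exhibits the CSP with respect to involutions having $a_n$ fixed points if for every $n\ge0$ and every involution $\phi$ of $\mathfrak{S}_n$ with exactly $a_n$ fixed points, $(\mathfrak{S}_n,\{\mathrm{id},\phi\},\sum_{\sigma\in\mathfrak{S}_n}q^{\mathrm{stat}(\sigma)})$ exhibits the CSP. -}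

module Defs where

open import Data.Nat as ℕ using (ℕ; zero; suc; _^_)
open import Data.Integer as ℤ using (ℤ; +_; -_; 1ℤ; -1ℤ)
open import Data.Fin as Fin using (Fin; _<_; _≤_)
open import Data.Fin.Properties as FinP using ()
open import Data.Vec as Vec using (Vec; []; _∷_; lookup)
open import Data.Vec.Properties using (≡-dec)
open import Data.List as List using (List; []; _∷_; length; map; filter; concatMap; allFin)
open import Data.Bool.ListAction using (and; any; all)
open import Data.Bool using (Bool; true; false; T; _∧_; _∨_; not)
open import Data.Product using (Σ; _,_; proj₁; proj₂; _×_)
open import Relation.Nullary using (Dec; yes; no; ¬_)
open import Relation.Nullary.Decidable using (⌊_⌋)
open import Relation.Binary.PropositionalEquality using (_≡_)
open import Function using (_∘_)

-- Permutations of [n] (0-based: elements of Fin n), one-line notation: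
-- a vector v of length n with v i = σ(i), required to be injective.
isPermB : ∀ {n} → Vec (Fin n) n → Bool
isPermB {n} v =
  and (map (λ i → and (map (λ j → ⌊ i Fin.≟ j ⌋ ∨ not ⌊ lookup v i Fin.≟ lookup v j ⌋)
                           (allFin n)))
           (allFin n))

Perm : ℕ → Set
Perm n = Σ (Vec (Fin n) n) (λ v → T (isPermB v))

app : ∀ {n} → Perm n → Fin n → Fin n
app σ i = lookup (proj₁ σ) i

allVecs : (n k : ℕ) → List (Vec (Fin n) k)
allVecs n zero = [] ∷ []
allVecs n (suc k) = concatMap (λ x → map (x ∷_) (allVecs n k)) (allFin n)

allPermsWith : ∀ {n} → (vs : List (Vec (Fin n) n)) → List (Perm n)
allPermsWith [] = []
allPermsWith (v ∷ vs) with isPermB v in eq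
... | true  = (v , Tt eq) ∷ allPermsWith vs
  where
    Tt : ∀ {b} → b ≡ true → T b
    Tt _≡_.refl = Data.Unit.tt
      where import Data.Unit
... | false = allPermsWith vs

allPerms : (n : ℕ) → List (Perm n)
allPerms n = allPermsWith (allVecs n n)

countB : ∀ {A : Set} → (A → Bool) → List A → ℕ
countB p xs = length (filter (λ x → Dec-T (p x)) xs)
  where
    Dec-T : (b : Bool) → Dec (T b)
    Dec-T true  = yes Data.Unit.tt
      where import Data.Unit
    Dec-T false = no (λ ())

iter : ∀ {n} → Perm n → ℕ → Fin n → Fin n
iter σ zero x = x
iter σ (suc m) x = app σ (iter σ m x)

wexx : ∀ {n} → Perm n → ℕ
wexx {n} σ = countB cond (allFin n)
  where
    cond : Fin n → Bool
    cond j = ⌊ j Fin.≤? app σ j ⌋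
           ∧ any (λ i → any (λ k → ⌊ i Fin.<? j ⌋ ∧ ⌊ j Fin.<? k ⌋
                                    ∧ ⌊ app σ j Fin.<? app σ i ⌋ ∧ ⌊ app σ k Fin.<? app σ j ⌋)
                            (allFin n))
                 (allFin n)

-- x is the smallest element of its cycle under σ: x ≤ σ^m(x) for all m
-- (m ranging over 0..n-1 suffices, as every cycle has length ≤ n).
isCycleMin : ∀ {n} → Perm n → Fin n → Bool
isCycleMin {n} σ x = all (λ m → ⌊ x Fin.≤? iter σ m x ⌋) (List.upTo n)

cdes : ∀ {n} → Perm n → ℕ
cdes {n} σ = countB (λ i → ⌊ app σ i Fin.<? i ⌋ ∧ not (isCycleMin σ (app σ i))) (allFin n)

genPoly : (n : ℕ) → (Perm n → ℕ) → ℤ → ℤ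
genPoly n stat q = List.foldr ℤ._+_ (+ 0) (map (λ σ → q ℤ.^ stat σ) (allPerms n))

IsInvolution : ∀ {n} → (Perm n → Perm n) → Set
IsInvolution φ = ∀ σ → φ (φ σ) ≡ σ

fixedPoints : ∀ {n} → (Perm n → Perm n) → ℕ
fixedPoints {n} φ = countB (λ σ → ⌊ ≡-dec Fin._≟_ (proj₁ (φ σ)) (proj₁ σ) ⌋) (allPerms n)

-- CSP for the group {id, φ} acting on 𝔖_n with polynomial f
CSP-inv : (n : ℕ) → (Perm n → Perm n) → (ℤ → ℤ) → Set
CSP-inv n φ f = (f 1ℤ ≡ + length (allPerms n)) × (f -1ℤ ≡ + fixedPoints φ)

a : ℕ → ℕ
a zero = 1
a (suc m) = 2 ^ m

ExhibitsCSP : (∀ {n} → Perm n → ℕ) → Set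
ExhibitsCSP stat = ∀ (n : ℕ) (φ : Perm n → Perm n) → IsInvolution φ →
  fixedPoints φ ≡ a n → CSP-inv n φ (genPoly n stat)

{-# OPTIONS --safe #-}
-- For the group {id, φ} the CSP only asks that f(1) = n! and that f(-1) is the
-- number of fixed points of φ, so both claims say that S(n) = Σ_{σ ∈ 𝔖_n} (-1)^stat(σ) equals
-- a_n.  Summing (-1)^stat over all words of length n, with weight 0 on non-permutations, we show
-- S(n+2) = 2 S(n+1).  Permutations with σ(0) = 0 contribute S(n+1), since both statistics ignore
-- a fixed point 0.  For wexx, exchanging the first two letters preserves wexx when one of them is
-- 0 (matching σ(1) = 0 with σ(0) = 0) and otherwise changes wexx by exactly one, because
-- position 1 is counted iff σ(0) > σ(1) > 0.  For cdes, exchanging the values 0 and 1 preserves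
-- cdes when σ(0) = 0 (matching σ(0) = 1 with σ(0) = 0) and otherwise changes it by one:
-- composing with the transposition (0 1) splits or merges the cycles through 0 and 1, so 1 is
-- a cycle minimum of exactly one of σ and (0 1)σ.
module Submission where

open import Defs
open import Data.Product using (_×_)

open import Data.Bool using (Bool; true; false; T; _∧_; _∨_; not; if_then_else_)
open import Data.Bool.ListAction using (and; all; any)
open import Data.Bool.Properties using (T-≡; ⇔→≡; not-involutive)
open import Data.Empty using (⊥; ⊥-elim)
open import Data.Fin as Fin using (Fin; zero; suc; toℕ)
import Data.Fin.Properties as Fin
open import Data.Integer as ℤ using (ℤ; +_; -_; 1ℤ; -1ℤ)
import Data.Integer.Properties as ℤ
open import Data.List using (List; []; _∷_; _++_; foldr; length; map; concatMap; tabulate; allFin; upTo)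
open import Data.List.Membership.Propositional using (lose)
open import Data.List.Membership.Propositional.Properties using (∈-allFin; ∈-upTo⁺; ∈-upTo⁻)
open import Data.List.Properties using (map-++; map-∘; map-cong)
import Data.List.Relation.Unary.All as All
open import Data.List.Relation.Unary.All.Properties using (all⁺; all⁻)
open import Data.List.Relation.Unary.Any using (satisfied)
open import Data.List.Relation.Unary.Any.Properties using (any⁺; any⁻)
open import Data.Nat as ℕ using (ℕ; zero; suc; _+_; _∸_; z≤n; s≤s)
open import Data.Nat.DivMod using (_%_; _/_; m%n<n; m≡m%n+[m/n]*n)
open import Data.Nat.GeneralisedArithmetic using (fold; fold-+)
open import Data.Nat.Induction using (<-rec)
import Data.Nat.Properties as ℕ
open import Data.Nat.Solver using (module +-*-Solver)
open import Data.Product using (∃; ∃₂; _,_; proj₁; proj₂)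
open import Data.Sum using (inj₁; inj₂)
open import Data.Unit using (⊤; tt)
open import Data.Vec as Vec using (Vec; []; _∷_; lookup)
import Data.Vec.Properties as Vec
open import Function using (_∘_; flip; _⇔_; mk⇔; Equivalence; Injective; case_of_)
import Function.Properties.Equivalence as ⇔
open import Relation.Binary.Definitions using (tri<; tri≈; tri>)
open import Relation.Binary.PropositionalEquality
open import Relation.Nullary using (¬_; Dec; yes; no; does; contradiction)
open import Relation.Nullary.Decidable using (⌊_⌋; toWitness; fromWitness; dec-true; dec-false)

open import Algebra.Properties.CommutativeMonoid.Sum ℤ.+-0-commutativeMonoid
  using (sum-syntax; sum-cong-≗; sum-replicate-zero; ∑-comm; ∑-distrib-+)
open import Algebra.Properties.CommutativeSemigroup ℕ.+-commutativeSemigroup using (xy∙z≈xz∙y)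
open import Algebra.Properties.CommutativeSemigroup ℤ.+-commutativeSemigroup using (x∙yz≈y∙xz)

open Equivalence using (to; from)

private
  variable
    m n : ℕ

T-injective : ∀ {b c} → (T b ⇔ T c) → b ≡ c
T-injective b⇔c = ⇔→≡ (⇔.trans (⇔.sym T-≡) (⇔.trans b⇔c T-≡))

¬T⇒≡false : ∀ {b} → ¬ T b → b ≡ false
¬T⇒≡false ¬t = T-injective (mk⇔ ¬t λ ())

T-⌊⌋∧ : {A : Set} (a? : Dec A) {b : Bool} → T (⌊ a? ⌋ ∧ b) ⇔ (A × T b)
T-⌊⌋∧ (yes a) = mk⇔ (a ,_) proj₂
T-⌊⌋∧ (no ¬a) = mk⇔ (λ ()) (λ (a , _) → ¬a a)

≡not-by-exclusion : {b c : Bool} {P Q : Set} → (T b ⇔ (¬ P)) → (T c ⇔ (¬ Q)) →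
                    (P → ¬ Q) → (¬ P → ¬ Q → ⊥) → c ≡ not b
≡not-by-exclusion {true}  {true}  b⇔¬P c⇔¬Q _         exhaustive =
  ⊥-elim (exhaustive (to b⇔¬P tt) (to c⇔¬Q tt))
≡not-by-exclusion {true}  {false} _    _    _         _          = refl
≡not-by-exclusion {false} {true}  _    _    _         _          = refl
≡not-by-exclusion {false} {false} b⇔¬P c⇔¬Q exclusive _          =
  ⊥-elim (from b⇔¬P (λ p → from c⇔¬Q (exclusive p)))

∧-not-∧ : ∀ a b c → (a ≡ false → c ≡ false) → (b ≡ false → c ≡ true) →
          (a ≡ false → b ≡ false → ⊥) → a ∧ c ≡ not (b ∧ not c)
∧-not-∧ true  true  true  _  _  _  = refl
∧-not-∧ true  true  false _  _  _  = refl
∧-not-∧ true  false c     _  h₁ _  = h₁ refl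
∧-not-∧ false true  c     h₀ _  _  = sym (cong (not ∘ not) (h₀ refl))
∧-not-∧ false false c     _  _  h₂ = ⊥-elim (h₂ refl refl)

T-all-allFin : ∀ {p : Fin n → Bool} → T (all p (allFin n)) ⇔ (∀ i → T (p i))
T-all-allFin {n} {p} = mk⇔
  (λ t i → All.lookup (all⁺ p (allFin n) t) (∈-allFin i))
  (λ h → all⁻ p {allFin n} (All.tabulate (λ {i} _ → h i)))

T-any-allFin : ∀ {p : Fin n → Bool} → T (any p (allFin n)) ⇔ ∃ (T ∘ p)
T-any-allFin {n} {p} = mk⇔
  (satisfied ∘ any⁻ p (allFin n))
  (λ (i , t) → any⁺ p (lose (∈-allFin i) t))

T-all-upTo : ∀ {p : ℕ → Bool} → T (all p (upTo n)) ⇔ (∀ k → k ℕ.< n → T (p k))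
T-all-upTo {n} {p} = mk⇔
  (λ t k k<n → All.lookup (all⁺ p (upTo n) t) (∈-upTo⁺ k<n))
  (λ h → all⁻ p {upTo n} (All.tabulate (λ k∈ → h _ (∈-upTo⁻ k∈))))

⟦_⟧ : Bool → ℕ
⟦ b ⟧ = if b then 1 else 0

count : (Fin n → Bool) → ℕ
count {zero}  p = 0
count {suc n} p = ⟦ p zero ⟧ + count (p ∘ suc)

countB-tabulate : ∀ {A : Set} (p : A → Bool) (f : Fin n → A) →
                  countB p (tabulate f) ≡ count (p ∘ f)
countB-tabulate {zero}  p f = refl
countB-tabulate {suc n} p f with p (f zero)
... | true  = cong suc (countB-tabulate p (f ∘ suc))
... | false = countB-tabulate p (f ∘ suc)

count-cong : {p q : Fin n → Bool} → (∀ i → p i ≡ q i) → count p ≡ count q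
count-cong {zero}  _   = refl
count-cong {suc n} p≗q = cong₂ _+_ (cong ⟦_⟧ (p≗q zero)) (count-cong (p≗q ∘ suc))

count-except : {p q : Fin n → Bool} (x : Fin n) → (∀ i → i ≢ x → p i ≡ q i) →
               count p + ⟦ q x ⟧ ≡ count q + ⟦ p x ⟧
count-except {suc n} {p} {q} zero agree
  rewrite count-cong {p = p ∘ suc} {q = q ∘ suc} (λ i → agree (suc i) λ ()) =
  solve 3 (λ a b c → (a :+ c) :+ b := (b :+ c) :+ a) refl
    ⟦ p zero ⟧ ⟦ q zero ⟧ (count (q ∘ suc))
  where open +-*-Solver using (solve; _:+_; _:=_)
count-except {suc n} {p} {q} (suc x) agree = begin
  ⟦ p zero ⟧ + count (p ∘ suc) + ⟦ q (suc x) ⟧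
    ≡⟨ ℕ.+-assoc ⟦ p zero ⟧ _ _ ⟩
  ⟦ p zero ⟧ + (count (p ∘ suc) + ⟦ q (suc x) ⟧)
    ≡⟨ cong₂ _+_ (cong ⟦_⟧ (agree zero λ ()))
                 (count-except x (λ i i≢x → agree (suc i) (i≢x ∘ Fin.suc-injective))) ⟩
  ⟦ q zero ⟧ + (count (q ∘ suc) + ⟦ p (suc x) ⟧)
    ≡⟨ ℕ.+-assoc ⟦ q zero ⟧ _ _ ⟨
  ⟦ q zero ⟧ + count (q ∘ suc) + ⟦ p (suc x) ⟧ ∎
  where open ≡-Reasoning

count-except₂ : {p q : Fin n → Bool} {x y : Fin n} → x ≢ y →
                (∀ i → i ≢ x → i ≢ y → p i ≡ q i) →
                count p + ⟦ q x ⟧ + ⟦ q y ⟧ ≡ count q + ⟦ p x ⟧ + ⟦ p y ⟧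
count-except₂ {n} {p} {q} {x} {y} x≢y agree = begin
  count p + ⟦ q x ⟧ + ⟦ q y ⟧  ≡⟨ cong (λ b → count p + ⟦ b ⟧ + ⟦ q y ⟧) r-x ⟨
  count p + ⟦ r x ⟧ + ⟦ q y ⟧  ≡⟨ cong (_+ ⟦ q y ⟧) (count-except x p≈r) ⟩
  count r + ⟦ p x ⟧ + ⟦ q y ⟧  ≡⟨ xy∙z≈xz∙y (count r) _ _ ⟩
  count r + ⟦ q y ⟧ + ⟦ p x ⟧  ≡⟨ cong (_+ ⟦ p x ⟧) (count-except y r≈q) ⟩
  count q + ⟦ r y ⟧ + ⟦ p x ⟧  ≡⟨ cong (λ b → count q + ⟦ b ⟧ + ⟦ p x ⟧) r-y ⟩
  count q + ⟦ p y ⟧ + ⟦ p x ⟧  ≡⟨ xy∙z≈xz∙y (count q) _ _ ⟩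
  count q + ⟦ p x ⟧ + ⟦ p y ⟧  ∎
  where
  open ≡-Reasoning
  -- r agrees with p away from x and with q away from y.
  r : Fin n → Bool
  r i = if does (i Fin.≟ x) then q x else p i
  r-x : r x ≡ q x
  r-x rewrite dec-true (x Fin.≟ x) refl = refl
  r-y : r y ≡ p y
  r-y rewrite dec-false (y Fin.≟ x) (x≢y ∘ sym) = refl
  p≈r : ∀ i → i ≢ x → p i ≡ r i
  p≈r i i≢x rewrite dec-false (i Fin.≟ x) i≢x = refl
  r≈q : ∀ i → i ≢ y → r i ≡ q i
  r≈q i i≢y with i Fin.≟ x
  ... | yes refl = refl
  ... | no i≢x   = agree i i≢x i≢y

-- Orbits of injective maps

least-witness : {P : ℕ → Set} → (∀ k → Dec (P k)) → ∀ {k} → P k →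
                ∃ λ m → P m × (∀ j → j ℕ.< m → ¬ P j)
least-witness {P} P? {k} = <-rec (λ k → P k → Least) search k
  where
  Least : Set
  Least = ∃ λ m → P m × (∀ j → j ℕ.< m → ¬ P j)
  search : ∀ k → (∀ {j} → j ℕ.< k → P j → Least) → P k → Least
  search k earlier pk with ℕ.anyUpTo? P? k
  ... | yes (j , j<k , pj) = earlier j<k pj
  ... | no none            = k , pk , λ j j<k pj → none (j , j<k , pj)

fold-periodic : {A : Set} {f : A → A} {x : A} {p : ℕ} → fold x f p ≡ x →
                ∀ q r → fold x f (r + q ℕ.* p) ≡ fold x f r
fold-periodic {f = f} {x} {p} fp q r = trans (fold-+ x f r) (cong (λ z → fold z f r) (multiple q))
  where
  multiple : ∀ q → fold x f (q ℕ.* p) ≡ x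
  multiple zero    = refl
  multiple (suc q) = trans (fold-+ x f p) (trans (cong (λ z → fold z f p) (multiple q)) fp)

module _ {f : Fin n → Fin n} (f-injective : Injective _≡_ _≡_ f) where

  fold-injective : ∀ k {x y} → fold x f k ≡ fold y f k → x ≡ y
  fold-injective zero    = λ eq → eq
  fold-injective (suc k) = fold-injective k ∘ f-injective

  period : ∀ x → ∃ λ p → 0 ℕ.< p × p ℕ.≤ n × fold x f p ≡ x
  period x with Fin.pigeonhole (ℕ.n<1+n n) (λ (k : Fin (suc n)) → fold x f (toℕ k))
  ... | i , j , i<j , fi≡fj =
    toℕ j ∸ toℕ i ,
    ℕ.m<n⇒0<n∸m i<j ,
    ℕ.≤-trans (ℕ.m∸n≤m (toℕ j) (toℕ i)) (ℕ.s≤s⁻¹ (Fin.toℕ<n j)) ,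
    fold-injective (toℕ i) (begin
      fold (fold x f (toℕ j ∸ toℕ i)) f (toℕ i)  ≡⟨ fold-+ x f (toℕ i) ⟨
      fold x f (toℕ i + (toℕ j ∸ toℕ i))
        ≡⟨ cong (fold x f) (ℕ.m+[n∸m]≡n (ℕ.<⇒≤ i<j)) ⟩
      fold x f (toℕ j)                           ≡⟨ fi≡fj ⟨
      fold x f (toℕ i)                           ∎)
    where open ≡-Reasoning

  fold-below : ∀ x k → ∃ λ j → j ℕ.< n × fold x f k ≡ fold x f j
  fold-below x k with period x
  ... | p , 0<p , p≤n , fp =
    k % p , ℕ.≤-trans (m%n<n k p) p≤n ,
    trans (cong (fold x f) (m≡m%n+[m/n]*n k p)) (fold-periodic fp (k / p) (k % p))
    where instance
      p≢0 : ℕ.NonZero p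
      p≢0 = ℕ.>-nonZero 0<p

injective⇒surjective : {f : Fin n → Fin n} → Injective _≡_ _≡_ f → ∀ y → ∃ λ x → f x ≡ y
injective⇒surjective {suc n} {f} f-injective y with Fin.any? (λ x → f x Fin.≟ y)
... | yes hit = hit
... | no miss = contradiction (Fin.injective⇒≤ punched-injective) ℕ.1+n≰n
  where
  f≢y : ∀ x → y ≢ f x
  f≢y x y≡fx = miss (x , sym y≡fx)
  punched-injective : Injective _≡_ _≡_ (λ x → Fin.punchOut (f≢y x))
  punched-injective eq = f-injective (Fin.punchOut-injective (f≢y _) (f≢y _) eq)

-- `fold x f k` is the iterate f^k(x).
Reaches : {A : Set} → (A → A) → A → A → Set
Reaches f x y = ∃ λ k → fold x f k ≡ y

-- g = (x y) ∘ f, stated pointwise.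
record Transposed {A : Set} (x y : A) (f g : A → A) : Set where
  field
    x↦y   : ∀ {z} → f z ≡ x → g z ≡ y
    y↦x   : ∀ {z} → f z ≡ y → g z ≡ x
    fixes : ∀ {z} → f z ≢ x → f z ≢ y → g z ≡ f z

module _ {f g : Fin n → Fin n} {x y : Fin n} (fg : Transposed x y f g) where
  open Transposed fg

  orbit-prefix-agrees : ∀ {w} b →
                        (∀ j → j ℕ.< b → fold w f (suc j) ≢ x × fold w f (suc j) ≢ y) →
                        ∀ k → k ℕ.≤ b → fold w g k ≡ fold w f k
  orbit-prefix-agrees b avoids zero    _   = refl
  orbit-prefix-agrees b avoids (suc k) k<b =
    trans (cong g (orbit-prefix-agrees b avoids k (ℕ.<⇒≤ k<b)))
          (fixes (proj₁ (avoids k k<b)) (proj₂ (avoids k k<b)))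

  -- Let a be the first time the f-orbit of x hits y.  Before that it avoids x and y, so the
  -- g-orbit follows it, and at time a the transposition sends g back to x: the g-orbit of x
  -- consists of the first a points of the f-orbit, none of which is y.
  reaches-exclusive : x ≢ y → Reaches f x y → ¬ Reaches g x y
  reaches-exclusive x≢y (k₀ , fk₀≡y) (k , gk≡y)
    with least-witness (λ k → fold x f k Fin.≟ y) {k₀} fk₀≡y
  ... | zero  , fa≡y , _      = x≢y fa≡y
  ... | suc a , fa≡y , before = before j (s≤s j≤a) (begin
    fold x f j ≡⟨ agrees j j≤a ⟨
    fold x g j ≡⟨ gk≡gj ⟨
    fold x g k ≡⟨ gk≡y ⟩
    y          ∎)
    where
    open ≡-Reasoning
    no-return : ∀ j → 0 ℕ.< j → j ℕ.< suc a → fold x f j ≢ x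
    no-return j 0<j j<a back = before (suc a ∸ j) (ℕ.∸-monoʳ-< 0<j (ℕ.<⇒≤ j<a)) (begin
      fold x f (suc a ∸ j)             ≡⟨ cong (λ z → fold z f (suc a ∸ j)) back ⟨
      fold (fold x f j) f (suc a ∸ j)  ≡⟨ fold-+ x f (suc a ∸ j) ⟨
      fold x f (suc a ∸ j + j)         ≡⟨ cong (fold x f) (ℕ.m∸n+n≡m (ℕ.<⇒≤ j<a)) ⟩
      fold x f (suc a)                 ≡⟨ fa≡y ⟩
      y                                ∎)
    agrees : ∀ j → j ℕ.≤ a → fold x g j ≡ fold x f j
    agrees = orbit-prefix-agrees a λ j j<a →
      no-return (suc j) (s≤s z≤n) (s≤s j<a) , before (suc j) (s≤s j<a)
    closes : fold x g (suc a) ≡ x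
    closes = y↦x (trans (cong f (agrees a ℕ.≤-refl)) fa≡y)
    within : ∀ k → ∃ λ j → j ℕ.≤ a × fold x g k ≡ fold x g j
    within zero = 0 , z≤n , refl
    within (suc k) with within k
    ... | j , j≤a , gk≡gj with ℕ.m≤n⇒m<n∨m≡n j≤a
    ...   | inj₁ j<a  = suc j , j<a , cong g gk≡gj
    ...   | inj₂ refl = 0 , z≤n , trans (cong g gk≡gj) closes
    j = proj₁ (within k)
    j≤a = proj₁ (proj₂ (within k))
    gk≡gj = proj₂ (proj₂ (within k))

  -- If neither orbit meets y, they coincide forever; but the f-orbit of x returns to x, and
  -- at that step g goes to y instead.
  reaches-exhaustive : Injective _≡_ _≡_ f → ¬ Reaches f x y → ¬ Reaches g x y → ⊥
  reaches-exhaustive f-injective ¬fxy ¬gxy with period f-injective x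
  ... | suc p , _ , _ , fp≡x = ¬gxy (suc p , trans (cong g (agrees p)) (x↦y fp≡x))
    where
    agrees : ∀ k → fold x g k ≡ fold x f k
    agrees zero = refl
    agrees (suc k) with fold x f (suc k) Fin.≟ x
    ... | yes back = contradiction (suc k , trans (cong g (agrees k)) (x↦y back)) ¬gxy
    ... | no ¬back = trans (cong g (agrees k)) (fixes ¬back (λ fk≡y → ¬fxy (suc k , fk≡y)))

∑-neg : (f : Fin n → ℤ) → ∑[ i < n ] (- f i) ≡ - ∑[ i < n ] f i
∑-neg {zero}  f = refl
∑-neg {suc n} f = trans (cong (ℤ._+_ (- f zero)) (∑-neg (f ∘ suc))) (sym (ℤ.neg-distrib-+ (f zero) _))

i≡-i⇒i≡0 : {i : ℤ} → i ≡ - i → i ≡ + 0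
i≡-i⇒i≡0 {+ zero}      _  = refl
i≡-i⇒i≡0 {ℤ.+[1+ _ ]} ()
i≡-i⇒i≡0 {ℤ.-[1+ _ ]} ()

∑∑-antisymmetric : (f : Fin n → Fin n → ℤ) → (∀ i j → f i j ≡ - f j i) →
                   ∑[ i < n ] ∑[ j < n ] f i j ≡ + 0
∑∑-antisymmetric {n} f anti = i≡-i⇒i≡0 (begin
  ∑[ i < n ] ∑[ j < n ] f i j       ≡⟨ ∑-comm f ⟩
  ∑[ j < n ] ∑[ i < n ] f i j       ≡⟨ sum-cong-≗ (λ j → sum-cong-≗ (λ i → anti i j)) ⟩
  ∑[ j < n ] ∑[ i < n ] (- f j i)   ≡⟨ sum-cong-≗ (λ j → ∑-neg (f j)) ⟩
  ∑[ j < n ] (- ∑[ i < n ] f j i)   ≡⟨ ∑-neg (λ j → ∑[ i < n ] f j i) ⟩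
  - ∑[ j < n ] ∑[ i < n ] f j i     ∎)
  where open ≡-Reasoning

swap01 : Fin (suc (suc n)) → Fin (suc (suc n))
swap01 zero          = suc zero
swap01 (suc zero)    = zero
swap01 (suc (suc i)) = suc (suc i)

swap01-involutive : (i : Fin (suc (suc n))) → swap01 (swap01 i) ≡ i
swap01-involutive zero          = refl
swap01-involutive (suc zero)    = refl
swap01-involutive (suc (suc i)) = refl

swap01-fixes : (i : Fin (suc (suc n))) → i ≢ zero → i ≢ suc zero → swap01 i ≡ i
swap01-fixes zero          i≢0 _   = contradiction refl i≢0
swap01-fixes (suc zero)    _   i≢1 = contradiction refl i≢1
swap01-fixes (suc (suc i)) _   _   = refl

∑-swap01 : (h : Fin (suc (suc n)) → ℤ) →
           ∑[ i < suc (suc n) ] h (swap01 i) ≡ ∑[ i < suc (suc n) ] h i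
∑-swap01 h = x∙yz≈y∙xz (h (suc zero)) (h zero) _

∑ⱽ : ∀ k → (Vec (Fin n) k → ℤ) → ℤ
∑ⱽ     zero    F = F []
∑ⱽ {n} (suc k) F = ∑[ x < n ] ∑ⱽ k (λ r → F (x ∷ r))

∑ⱽ-cong : ∀ k {F G : Vec (Fin n) k → ℤ} → (∀ r → F r ≡ G r) → ∑ⱽ k F ≡ ∑ⱽ k G
∑ⱽ-cong zero    F≗G = F≗G []
∑ⱽ-cong (suc k) F≗G = sum-cong-≗ (λ x → ∑ⱽ-cong k (λ r → F≗G (x ∷ r)))

∑ⱽ-zero : ∀ k {F : Vec (Fin n) k → ℤ} → (∀ r → F r ≡ + 0) → ∑ⱽ k F ≡ + 0
∑ⱽ-zero     zero    F≗0 = F≗0 []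
∑ⱽ-zero {n} (suc k) F≗0 =
  trans (sum-cong-≗ (λ x → ∑ⱽ-zero k (λ r → F≗0 (x ∷ r)))) (sum-replicate-zero n)

∑ⱽ-neg : ∀ k (F : Vec (Fin n) k → ℤ) → ∑ⱽ k (λ r → - F r) ≡ - ∑ⱽ k F
∑ⱽ-neg zero    F = refl
∑ⱽ-neg (suc k) F =
  trans (sum-cong-≗ (λ x → ∑ⱽ-neg k (λ r → F (x ∷ r)))) (∑-neg (λ x → ∑ⱽ k (λ r → F (x ∷ r))))

module _ (s : Fin n → Fin n)
         (∑-invariant : ∀ (h : Fin n → ℤ) → ∑[ i < n ] h (s i) ≡ ∑[ i < n ] h i) where

  ∑ⱽ-map : ∀ k (F : Vec (Fin n) k → ℤ) → ∑ⱽ k (F ∘ Vec.map s) ≡ ∑ⱽ k F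
  ∑ⱽ-map zero    F = refl
  ∑ⱽ-map (suc k) F = trans (sum-cong-≗ (λ x → ∑ⱽ-map k (λ r → F (s x ∷ r))))
                           (∑-invariant (λ y → ∑ⱽ k (λ r → F (y ∷ r))))

  ∑ⱽ-sign-reversing : ∀ k (F : Vec (Fin n) k → ℤ) → (∀ r → F (Vec.map s r) ≡ - F r) →
                      ∑ⱽ k F ≡ + 0
  ∑ⱽ-sign-reversing k F reverses = i≡-i⇒i≡0 (begin
    ∑ⱽ k F                  ≡⟨ ∑ⱽ-map k F ⟨
    ∑ⱽ k (F ∘ Vec.map s)    ≡⟨ ∑ⱽ-cong k reverses ⟩
    ∑ⱽ k (λ r → - F r)      ≡⟨ ∑ⱽ-neg k F ⟩
    - ∑ⱽ k F                ∎)
    where open ≡-Reasoning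

∑ⱽ-lift : ∀ k (F : Vec (Fin (suc n)) k → ℤ) → (∀ r i → lookup r i ≡ zero → F r ≡ + 0) →
          ∑ⱽ k F ≡ ∑ⱽ k (F ∘ Vec.map suc)
∑ⱽ-lift     zero    F _          = refl
∑ⱽ-lift {n} (suc k) F F-vanishes = begin
  ∑ⱽ k (λ r → F (zero ∷ r)) ℤ.+ rest
    ≡⟨ cong (ℤ._+ rest) (∑ⱽ-zero k (λ r → F-vanishes (zero ∷ r) zero refl)) ⟩
  + 0 ℤ.+ rest
    ≡⟨ ℤ.+-identityˡ rest ⟩
  ∑[ x < n ] ∑ⱽ k (λ r → F (suc x ∷ r))
    ≡⟨ sum-cong-≗ (λ x → ∑ⱽ-lift k (λ r → F (suc x ∷ r)) (λ r i → F-vanishes (suc x ∷ r) (suc i))) ⟩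
  ∑[ x < n ] ∑ⱽ k (λ r → F (suc x ∷ Vec.map suc r)) ∎
  where
  open ≡-Reasoning
  rest : ℤ
  rest = ∑[ x < n ] ∑ⱽ k (λ r → F (suc x ∷ r))

-- Generating polynomials as signed sums over words

weight : ((Fin n → Fin n) → ℕ) → ℤ → Vec (Fin n) n → ℤ
weight s q v = if isPermB v then q ℤ.^ s (lookup v) else + 0

∑ˡ : List ℤ → ℤ
∑ˡ = foldr ℤ._+_ (+ 0)

∑ˡ-++ : ∀ xs ys → ∑ˡ (xs ++ ys) ≡ ∑ˡ xs ℤ.+ ∑ˡ ys
∑ˡ-++ []       ys = sym (ℤ.+-identityˡ (∑ˡ ys))
∑ˡ-++ (x ∷ xs) ys = trans (cong (ℤ._+_ x) (∑ˡ-++ xs ys)) (sym (ℤ.+-assoc x (∑ˡ xs) (∑ˡ ys)))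

∑ˡ-map-concatMap : {A B : Set} (F : B → ℤ) (g : A → List B) (xs : List A) →
                   ∑ˡ (map F (concatMap g xs)) ≡ ∑ˡ (map (λ x → ∑ˡ (map F (g x))) xs)
∑ˡ-map-concatMap F g []       = refl
∑ˡ-map-concatMap F g (x ∷ xs) = begin
  ∑ˡ (map F (g x ++ concatMap g xs))                ≡⟨ cong ∑ˡ (map-++ F (g x) (concatMap g xs)) ⟩
  ∑ˡ (map F (g x) ++ map F (concatMap g xs))        ≡⟨ ∑ˡ-++ (map F (g x)) _ ⟩
  ∑ˡ (map F (g x)) ℤ.+ ∑ˡ (map F (concatMap g xs))
    ≡⟨ cong (ℤ._+_ (∑ˡ (map F (g x)))) (∑ˡ-map-concatMap F g xs) ⟩
  ∑ˡ (map F (g x)) ℤ.+ ∑ˡ (map (λ x → ∑ˡ (map F (g x))) xs) ∎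
  where open ≡-Reasoning

∑ˡ-map-tabulate : {A : Set} (F : A → ℤ) (f : Fin n → A) →
                  ∑ˡ (map F (tabulate f)) ≡ ∑[ i < n ] F (f i)
∑ˡ-map-tabulate {zero}  F f = refl
∑ˡ-map-tabulate {suc n} F f = cong (ℤ._+_ (F (f zero))) (∑ˡ-map-tabulate F (f ∘ suc))

∑ˡ-allVecs : ∀ k (F : Vec (Fin n) k → ℤ) → ∑ˡ (map F (allVecs n k)) ≡ ∑ⱽ k F
∑ˡ-allVecs     zero    F = ℤ.+-identityʳ (F [])
∑ˡ-allVecs {n} (suc k) F = begin
  ∑ˡ (map F (concatMap (λ x → map (x ∷_) (allVecs n k)) (allFin n)))
    ≡⟨ ∑ˡ-map-concatMap F (λ x → map (x ∷_) (allVecs n k)) (allFin n) ⟩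
  ∑ˡ (map (λ x → ∑ˡ (map F (map (x ∷_) (allVecs n k)))) (allFin n))
    ≡⟨ ∑ˡ-map-tabulate (λ x → ∑ˡ (map F (map (x ∷_) (allVecs n k)))) (λ x → x) ⟩
  ∑[ x < n ] ∑ˡ (map F (map (x ∷_) (allVecs n k)))
    ≡⟨ sum-cong-≗ (λ x → trans (cong ∑ˡ (sym (map-∘ (allVecs n k))))
                               (∑ˡ-allVecs k (λ r → F (x ∷ r)))) ⟩
  ∑ⱽ (suc k) F ∎
  where open ≡-Reasoning

private
  copy : {A : Set} {k : ℕ} → ⊤ → Vec A k → Vec A k
  copy _ []       = []
  copy t (x ∷ xs) = x ∷ copy t xs

  copy-id : {A : Set} {k : ℕ} (v : Vec A k) → copy tt v ≡ v
  copy-id []       = refl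
  copy-id (x ∷ xs) = cong (x ∷_) (copy-id xs)

  isPermB-copy : (t : ⊤) (v : Vec (Fin n) n) → isPermB (copy t v) ≡ isPermB (copy tt v)
  isPermB-copy _ _ = refl

module _ (stat : Perm n → ℕ) (s : (Fin n → Fin n) → ℕ) (stat≡s : ∀ σ → stat σ ≡ s (app σ))
         (q : ℤ) where

  private
    ∑ᵖ : List (Perm n) → ℤ
    ∑ᵖ σs = ∑ˡ (map (λ σ → q ℤ.^ stat σ) σs)

  -- `allPermsWith (v ∷ vs)` unfolds to a with-function applied to `isPermB v` and to a `refl`
  -- coming from `in eq`, so abstracting over `isPermB v` alone is ill-typed.  With `copy tt v`
  -- in place of `v`, the extra with-argument `isPermB-copy t v` (also `refl`, but typed via the
  -- variable `t`) is abstracted together with it.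
  ∑-allPermsWith-∷ : (t : ⊤) (v : Vec (Fin n) n) (vs : List (Vec (Fin n) n)) →
                     ∑ᵖ (allPermsWith (copy tt v ∷ vs)) ≡
                     weight s q (copy tt v) ℤ.+ ∑ᵖ (allPermsWith vs)
  ∑-allPermsWith-∷ t v vs with isPermB (copy tt v) | isPermB-copy t v
  ... | true  | _ = cong (λ k → q ℤ.^ k ℤ.+ ∑ᵖ (allPermsWith vs)) (stat≡s _)
  ... | false | _ = sym (ℤ.+-identityˡ _)

  ∑-allPermsWith : (vs : List (Vec (Fin n) n)) → ∑ᵖ (allPermsWith vs) ≡ ∑ˡ (map (weight s q) vs)
  ∑-allPermsWith []       = refl
  ∑-allPermsWith (v ∷ vs) = begin
    ∑ᵖ (allPermsWith (v ∷ vs))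
      ≡⟨ cong (λ u → ∑ᵖ (allPermsWith (u ∷ vs))) (copy-id v) ⟨
    ∑ᵖ (allPermsWith (copy tt v ∷ vs))
      ≡⟨ ∑-allPermsWith-∷ tt v vs ⟩
    weight s q (copy tt v) ℤ.+ ∑ᵖ (allPermsWith vs)
      ≡⟨ cong₂ ℤ._+_ (cong (weight s q) (copy-id v)) (∑-allPermsWith vs) ⟩
    weight s q v ℤ.+ ∑ˡ (map (weight s q) vs)
      ∎
    where open ≡-Reasoning

  genPoly≡∑ⱽ : genPoly n stat q ≡ ∑ⱽ n (weight s q)
  genPoly≡∑ⱽ = trans (∑-allPermsWith (allVecs n n)) (∑ˡ-allVecs n (weight s q))

genPoly-at-1 : (stat : Perm n → ℕ) → genPoly n stat 1ℤ ≡ + length (allPerms n)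
genPoly-at-1 {n} stat = ones (allPerms n)
  where
  ones : (σs : List (Perm n)) → ∑ˡ (map (λ σ → 1ℤ ℤ.^ stat σ) σs) ≡ + length σs
  ones []       = refl
  ones (σ ∷ σs) = cong₂ ℤ._+_ (ℤ.^-zeroˡ (stat σ)) (ones σs)

signedSum : (∀ {n} → (Fin n → Fin n) → ℕ) → ℕ → ℤ
signedSum s n = ∑ⱽ n (weight s -1ℤ)

csp-from-signed-sums : (stat : ∀ {n} → Perm n → ℕ) (s : ∀ {n} → (Fin n → Fin n) → ℕ) →
                       (∀ {n} (σ : Perm n) → stat σ ≡ s (app σ)) →
                       (∀ n → signedSum s n ≡ + a n) → ExhibitsCSP stat
csp-from-signed-sums stat s stat≡s signed n φ _ fix≡a =
  genPoly-at-1 {n} stat ,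
  trans (genPoly≡∑ⱽ {n} stat s stat≡s -1ℤ) (trans (signed n) (cong +_ (sym fix≡a)))

doubling⇒a : (g : ℕ → ℤ) → g 0 ≡ + 1 → g 1 ≡ + 1 →
             (∀ m → g (2 + m) ≡ g (1 + m) ℤ.+ g (1 + m)) → ∀ n → g n ≡ + a n
doubling⇒a g g0 g1 step zero          = g0
doubling⇒a g g0 g1 step (suc zero)    = g1
doubling⇒a g g0 g1 step (suc (suc m)) =
  trans (step m) (trans (cong₂ ℤ._+_ (doubling⇒a g g0 g1 step (suc m)) (doubling⇒a g g0 g1 step (suc m)))
                        (cong (λ k → + (2 ℕ.^ m + k)) (sym (ℕ.+-identityʳ (2 ℕ.^ m)))))

IsPerm : Vec (Fin n) n → Set
IsPerm v = Injective _≡_ _≡_ (lookup v)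

isPermB⇔IsPerm : {v : Vec (Fin n) n} → T (isPermB v) ⇔ IsPerm v
isPermB⇔IsPerm {n} {v} = mk⇔
  (λ t {i} {j} vi≡vj → to (pointwise i j) (to T-all-allFin (to T-all-allFin t i) j) vi≡vj)
  (λ inj → from T-all-allFin (λ i → from T-all-allFin (λ j → from (pointwise i j) inj)))
  where
  pointwise : ∀ i j → T (⌊ i Fin.≟ j ⌋ ∨ not ⌊ lookup v i Fin.≟ lookup v j ⌋) ⇔
                      (lookup v i ≡ lookup v j → i ≡ j)
  pointwise i j with i Fin.≟ j | lookup v i Fin.≟ lookup v j
  ... | yes i≡j | _          = mk⇔ (λ _ _ → i≡j) _
  ... | no _    | no vi≢vj   = mk⇔ (λ _ vi≡vj → contradiction vi≡vj vi≢vj) _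
  ... | no i≢j  | yes vi≡vj = mk⇔ (λ ()) (λ inj → i≢j (inj vi≡vj))

private
  isPermB-true⇒IsPerm : (u : Vec (Fin n) n) → isPermB u ≡ true → IsPerm u
  isPermB-true⇒IsPerm u eq = to (isPermB⇔IsPerm {v = u}) (subst T (sym eq) tt)

  isPermB-false⇒¬IsPerm : (u : Vec (Fin n) n) → isPermB u ≡ false → ¬ IsPerm u
  isPermB-false⇒¬IsPerm u eq p = subst T eq (from (isPermB⇔IsPerm {v = u}) p)

module _ (s : ∀ {n} → (Fin n → Fin n) → ℕ) (q : ℤ) where

  weight-nonperm : {v : Vec (Fin n) n} → ¬ IsPerm v → weight s q v ≡ + 0
  weight-nonperm {v = v} ¬perm with isPermB v in eq
  ... | true  = ⊥-elim (¬perm (λ {i j} → isPermB-true⇒IsPerm v eq))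
  ... | false = refl

  weight-transfer : {v : Vec (Fin m) m} {w : Vec (Fin n) n} (h : ℤ → ℤ) → h (+ 0) ≡ + 0 →
                    (IsPerm v ⇔ IsPerm w) → (IsPerm w → q ℤ.^ s (lookup v) ≡ h (q ℤ.^ s (lookup w))) →
                    weight s q v ≡ h (weight s q w)
  weight-transfer {v = v} {w = w} h h0 v⇔w related with isPermB v in ev | isPermB w in ew
  ... | true  | true  = related (λ {i j} → to v⇔w (isPermB-true⇒IsPerm v ev))
  ... | false | false = sym h0
  ... | true  | false = ⊥-elim (isPermB-false⇒¬IsPerm w ew (λ {i j} → to v⇔w (isPermB-true⇒IsPerm v ev)))
  ... | false | true  = ⊥-elim (isPermB-false⇒¬IsPerm v ev (λ {i j} → from v⇔w (isPermB-true⇒IsPerm w ew)))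

IsPerm-lift : {u : Vec (Fin n) n} → IsPerm (zero ∷ Vec.map suc u) ⇔ IsPerm u
IsPerm-lift {n} {u} = mk⇔
  (λ inj {i} {j} ui≡uj →
     Fin.suc-injective (inj (trans (lookup-suc i) (trans (cong suc ui≡uj) (sym (lookup-suc j))))))
  lifted
  where
  lookup-suc : ∀ i → lookup (Vec.map suc u) i ≡ suc (lookup u i)
  lookup-suc i = Vec.lookup-map i suc u
  lifted : IsPerm u → IsPerm (zero ∷ Vec.map suc u)
  lifted inj {zero}  {zero}  _ = refl
  lifted inj {zero}  {suc j} e = contradiction (trans e (lookup-suc j)) (λ ())
  lifted inj {suc i} {zero}  e = contradiction (trans (sym e) (lookup-suc i)) (λ ())
  lifted inj {suc i} {suc j} e =
    cong suc (inj (Fin.suc-injective (trans (sym (lookup-suc i)) (trans e (lookup-suc j)))))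

∑ⱽ-weight-fixing-zero : (s : ∀ {n} → (Fin n → Fin n) → ℕ) (q : ℤ) →
                        (∀ u → IsPerm u → s (lookup (zero ∷ Vec.map suc u)) ≡ s (lookup u)) →
                        ∑ⱽ n (λ r → weight s q (zero ∷ r)) ≡ ∑ⱽ n (weight s q)
∑ⱽ-weight-fixing-zero {n} s q s-lift = begin
  ∑ⱽ n (λ r → weight s q (zero ∷ r))               ≡⟨ ∑ⱽ-lift n (λ r → weight s q (zero ∷ r)) vanishes ⟩
  ∑ⱽ n (λ u → weight s q (zero ∷ Vec.map suc u))   ≡⟨ ∑ⱽ-cong n lifted ⟩
  ∑ⱽ n (weight s q)                                ∎
  where
  open ≡-Reasoning
  vanishes : ∀ r i → lookup r i ≡ zero → weight s q (zero ∷ r) ≡ + 0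
  vanishes r i ri≡0 =
    weight-nonperm s q {v = zero ∷ r} (λ inj → contradiction (inj {zero} {suc i} (sym ri≡0)) λ ())
  lifted : ∀ u → weight s q (zero ∷ Vec.map suc u) ≡ weight s q u
  lifted u = weight-transfer s q {v = zero ∷ Vec.map suc u} {w = u} (λ z → z) refl IsPerm-lift
                              (λ perm → cong (q ℤ.^_) (s-lift u perm))

-1^suc : ∀ k → -1ℤ ℤ.^ suc k ≡ - (-1ℤ ℤ.^ k)
-1^suc k = ℤ.-1*i≡-i (-1ℤ ℤ.^ k)

-1^-flip : ∀ x y b → x + ⟦ not b ⟧ ≡ y + ⟦ b ⟧ → -1ℤ ℤ.^ y ≡ - (-1ℤ ℤ.^ x)
-1^-flip x y true  x≡y+1 = begin
  -1ℤ ℤ.^ y              ≡⟨ ℤ.neg-involutive _ ⟨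
  - - (-1ℤ ℤ.^ y)        ≡⟨ cong -_ (-1^suc y) ⟨
  - (-1ℤ ℤ.^ suc y)      ≡⟨ cong (λ k → - (-1ℤ ℤ.^ k)) y+1≡x ⟩
  - (-1ℤ ℤ.^ x)          ∎
  where
  open ≡-Reasoning
  y+1≡x : suc y ≡ x
  y+1≡x = trans (ℕ.+-comm 1 y) (trans (sym x≡y+1) (ℕ.+-identityʳ x))
-1^-flip x y false x+1≡y = begin
  -1ℤ ℤ.^ y              ≡⟨ cong (-1ℤ ℤ.^_) y≡x+1 ⟩
  -1ℤ ℤ.^ suc x          ≡⟨ -1^suc x ⟩
  - (-1ℤ ℤ.^ x)          ∎
  where
  open ≡-Reasoning
  y≡x+1 : y ≡ suc x
  y≡x+1 = trans (sym (ℕ.+-identityʳ y)) (trans (sym x+1≡y) (ℕ.+-comm x 1))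

-- The statistic wexx

lookup-swap01 : {A : Set} (a b : A) (r : Vec A m) (i : Fin (suc (suc m))) →
                lookup (b ∷ a ∷ r) i ≡ lookup (a ∷ b ∷ r) (swap01 i)
lookup-swap01 a b r zero          = refl
lookup-swap01 a b r (suc zero)    = refl
lookup-swap01 a b r (suc (suc i)) = refl

IsPerm-swap01 : {a b : Fin (suc (suc m))} {r : Vec (Fin (suc (suc m))) m} →
                IsPerm (a ∷ b ∷ r) ⇔ IsPerm (b ∷ a ∷ r)
IsPerm-swap01 {a = a} {b} {r} = mk⇔ (swapped a b r) (swapped b a r)
  where
  swapped : ∀ a b r → IsPerm (a ∷ b ∷ r) → IsPerm (b ∷ a ∷ r)
  swapped a b r inj {i} {j} e = begin
    i                    ≡⟨ swap01-involutive i ⟨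
    swap01 (swap01 i)    ≡⟨ cong swap01 (inj (trans (sym (lookup-swap01 a b r i))
                                                   (trans e (lookup-swap01 a b r j)))) ⟩
    swap01 (swap01 j)    ≡⟨ swap01-involutive j ⟩
    j                    ∎
    where open ≡-Reasoning

wexxAt : (Fin n → Fin n) → Fin n → Bool
wexxAt {n} f j = ⌊ j Fin.≤? f j ⌋
  ∧ any (λ i → any (λ k → ⌊ i Fin.<? j ⌋ ∧ ⌊ j Fin.<? k ⌋ ∧ ⌊ f j Fin.<? f i ⌋ ∧ ⌊ f k Fin.<? f j ⌋)
                   (allFin n))
        (allFin n)

wexxF : (Fin n → Fin n) → ℕ
wexxF f = count (wexxAt f)

wexx≡wexxF : (σ : Perm n) → wexx σ ≡ wexxF (app σ)
wexx≡wexxF σ = countB-tabulate (wexxAt (app σ)) (λ i → i)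

IsWexx : (Fin n → Fin n) → Fin n → Set
IsWexx f j = j Fin.≤ f j × ∃₂ λ i k → i Fin.< j × j Fin.< k × f j Fin.< f i × f k Fin.< f j

wexxAt⇔IsWexx : {f : Fin n → Fin n} {j : Fin n} → T (wexxAt f j) ⇔ IsWexx f j
wexxAt⇔IsWexx {n} {f} {j} = mk⇔ to′ from′
  where
  to′ : T (wexxAt f j) → IsWexx f j
  to′ t =
    let j≤fj  , t₁ = to (T-⌊⌋∧ (j Fin.≤? f j)) t
        i     , t₂ = to T-any-allFin t₁
        k     , t₃ = to T-any-allFin t₂
        i<j   , t₄ = to (T-⌊⌋∧ (i Fin.<? j)) t₃
        j<k   , t₅ = to (T-⌊⌋∧ (j Fin.<? k)) t₄
        fj<fi , t₆ = to (T-⌊⌋∧ (f j Fin.<? f i)) t₅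
    in j≤fj , i , k , i<j , j<k , fj<fi , toWitness t₆
  from′ : IsWexx f j → T (wexxAt f j)
  from′ (j≤fj , i , k , i<j , j<k , fj<fi , fk<fj) =
    from (T-⌊⌋∧ (j Fin.≤? f j)) (j≤fj , from T-any-allFin (i , from T-any-allFin (k ,
      from (T-⌊⌋∧ (i Fin.<? j)) (i<j , from (T-⌊⌋∧ (j Fin.<? k)) (j<k ,
        from (T-⌊⌋∧ (f j Fin.<? f i)) (fj<fi , fromWitness fk<fj))))))

¬IsWexx-zero : {f : Fin (suc n) → Fin (suc n)} → ¬ IsWexx f zero
¬IsWexx-zero (_ , i , _ , () , _)

IsWexx-one⇒descent : {f : Fin (suc (suc n)) → Fin (suc (suc n))} →
                     IsWexx f (suc zero) → f (suc zero) Fin.< f zero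
IsWexx-one⇒descent (_ , zero  , _ , _      , _ , f1<f0 , _) = f1<f0
IsWexx-one⇒descent (_ , suc _ , _ , s≤s () , _)

swap01-< : {j : Fin n} (i : Fin (suc (suc n))) → i Fin.< suc (suc j) → swap01 i Fin.< suc (suc j)
swap01-< zero          _   = s≤s (s≤s z≤n)
swap01-< (suc zero)    _   = s≤s z≤n
swap01-< (suc (suc i)) i<j = i<j

IsWexx-swap01 : {f g : Fin (suc (suc n)) → Fin (suc (suc n))} → (∀ i → g i ≡ f (swap01 i)) →
                ∀ j → IsWexx f (suc (suc j)) → IsWexx g (suc (suc j))
IsWexx-swap01 _ j (_ , _ , suc zero , _ , s≤s () , _)
IsWexx-swap01 {f = f} {g} g≗f∘swap01 j (j≤fj , i , suc (suc k) , i<j , j<k , fj<fi , fk<fj) =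
  subst (suc (suc j) Fin.≤_) (sym gj) j≤fj ,
  swap01 i , suc (suc k) , swap01-< i i<j , j<k ,
  subst₂ Fin._<_ (sym gj) (sym gi) fj<fi ,
  subst₂ Fin._<_ (sym (g≗f∘swap01 (suc (suc k)))) (sym gj) fk<fj
  where
  gj : g (suc (suc j)) ≡ f (suc (suc j))
  gj = g≗f∘swap01 (suc (suc j))
  gi : g (swap01 i) ≡ f i
  gi = trans (g≗f∘swap01 (swap01 i)) (cong f (swap01-involutive i))

wexx-swap01 : {f g : Fin (suc (suc n)) → Fin (suc (suc n))} → (∀ i → g i ≡ f (swap01 i)) →
              wexxF f + ⟦ wexxAt g (suc zero) ⟧ ≡ wexxF g + ⟦ wexxAt f (suc zero) ⟧
wexx-swap01 {f = f} {g} g≗f∘swap01 = count-except (suc zero) agree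
  where
  f≗g∘swap01 : ∀ i → f i ≡ g (swap01 i)
  f≗g∘swap01 i = trans (cong f (sym (swap01-involutive i))) (sym (g≗f∘swap01 (swap01 i)))
  agree : ∀ j → j ≢ suc zero → wexxAt f j ≡ wexxAt g j
  agree zero          _   = T-injective (mk⇔ (⊥-elim ∘ ¬IsWexx-zero ∘ to (wexxAt⇔IsWexx {f = f}))
                                             (⊥-elim ∘ ¬IsWexx-zero ∘ to (wexxAt⇔IsWexx {f = g})))
  agree (suc zero)    1≢1 = contradiction refl 1≢1
  agree (suc (suc j)) _   = T-injective (⇔.trans (wexxAt⇔IsWexx {f = f}) (⇔.trans
    (mk⇔ (IsWexx-swap01 g≗f∘swap01 j) (IsWexx-swap01 f≗g∘swap01 j)) (⇔.sym (wexxAt⇔IsWexx {f = g}))))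

wexx-swap-zero : {a : Fin (suc (suc m))} {r : Vec (Fin (suc (suc m))) m} →
                 wexxF (lookup (a ∷ zero ∷ r)) ≡ wexxF (lookup (zero ∷ a ∷ r))
wexx-swap-zero {m} {a} {r} = ℕ.+-cancelʳ-≡ 0 (wexxF f) (wexxF g) (begin
  wexxF f + 0                        ≡⟨ cong (λ b → wexxF f + ⟦ b ⟧) g-one ⟨
  wexxF f + ⟦ wexxAt g (suc zero) ⟧  ≡⟨ wexx-swap01 {f = f} {g} (lookup-swap01 a zero r) ⟩
  wexxF g + ⟦ wexxAt f (suc zero) ⟧  ≡⟨ cong (λ b → wexxF g + ⟦ b ⟧) f-one ⟩
  wexxF g + 0                        ∎)
  where
  open ≡-Reasoning
  f g : Fin (suc (suc m)) → Fin (suc (suc m))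
  f = lookup (a ∷ zero ∷ r)
  g = lookup (zero ∷ a ∷ r)
  g-one : wexxAt g (suc zero) ≡ false
  g-one = ¬T⇒≡false (λ t → case IsWexx-one⇒descent (to (wexxAt⇔IsWexx {f = g} {j = suc zero}) t) of λ ())
  f-one : wexxAt f (suc zero) ≡ false
  f-one = ¬T⇒≡false (λ t → case proj₁ (to (wexxAt⇔IsWexx {f = f} {j = suc zero}) t) of λ ())

module _ {a : Fin (suc (suc m))} {b : Fin (suc m)} {r : Vec (Fin (suc (suc m))) m} where

  private
    f g : Fin (suc (suc m)) → Fin (suc (suc m))
    f = lookup (a ∷ suc b ∷ r)
    g = lookup (suc b ∷ a ∷ r)

  descent⇒IsWexx-one : IsPerm (a ∷ suc b ∷ r) → suc b Fin.< a → IsWexx f (suc zero)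
  descent⇒IsWexx-one perm b<a with injective⇒surjective perm zero
  ... | zero        , a≡0  = contradiction (subst (suc b Fin.<_) a≡0 b<a) λ ()
  ... | suc (suc k) , rk≡0 =
    s≤s z≤n , zero , suc (suc k) , s≤s z≤n , s≤s (s≤s z≤n) , b<a ,
    subst (Fin._< suc b) (sym rk≡0) (s≤s z≤n)

  wexx-swap-descent : IsPerm (a ∷ suc b ∷ r) → suc b Fin.< a → wexxF f ≡ suc (wexxF g)
  wexx-swap-descent perm b<a = begin
    wexxF f                            ≡⟨ ℕ.+-identityʳ (wexxF f) ⟨
    wexxF f + 0                        ≡⟨ cong (λ c → wexxF f + ⟦ c ⟧) g-one ⟨
    wexxF f + ⟦ wexxAt g (suc zero) ⟧  ≡⟨ wexx-swap01 {f = f} {g} (lookup-swap01 a (suc b) r) ⟩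
    wexxF g + ⟦ wexxAt f (suc zero) ⟧  ≡⟨ cong (λ c → wexxF g + ⟦ c ⟧) f-one ⟩
    wexxF g + 1                        ≡⟨ ℕ.+-comm (wexxF g) 1 ⟩
    suc (wexxF g)                      ∎
    where
    open ≡-Reasoning
    g-one : wexxAt g (suc zero) ≡ false
    g-one = ¬T⇒≡false λ t →
      ℕ.<-asym b<a (IsWexx-one⇒descent (to (wexxAt⇔IsWexx {f = g} {j = suc zero}) t))
    f-one : wexxAt f (suc zero) ≡ true
    f-one = to T-≡ (from (wexxAt⇔IsWexx {f = f} {j = suc zero}) (descent⇒IsWexx-one perm b<a))

module _ {r : Vec (Fin (suc (suc m))) m} where

  weight-wexx-swap-zero : (q : ℤ) {a : Fin (suc (suc m))} →
                          weight wexxF q (a ∷ zero ∷ r) ≡ weight wexxF q (zero ∷ a ∷ r)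
  weight-wexx-swap-zero q {a} =
    weight-transfer wexxF q {v = a ∷ zero ∷ r} {w = zero ∷ a ∷ r} (λ z → z) refl IsPerm-swap01
      (λ _ → cong (q ℤ.^_) (wexx-swap-zero {a = a} {r}))

  weight-wexx-swap-suc : {a b : Fin (suc m)} →
                         weight wexxF -1ℤ (suc a ∷ suc b ∷ r) ≡
                         - weight wexxF -1ℤ (suc b ∷ suc a ∷ r)
  weight-wexx-swap-suc {a} {b} =
    weight-transfer wexxF -1ℤ {v = suc a ∷ suc b ∷ r} {w = suc b ∷ suc a ∷ r} -_ refl IsPerm-swap01 related
    where
    open ≡-Reasoning
    x y : ℕ
    x = wexxF (lookup (suc a ∷ suc b ∷ r))
    y = wexxF (lookup (suc b ∷ suc a ∷ r))
    related : IsPerm (suc b ∷ suc a ∷ r) → -1ℤ ℤ.^ x ≡ - (-1ℤ ℤ.^ y)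
    related perm with Fin.<-cmp a b
    ... | tri< a<b _ _ = begin
      -1ℤ ℤ.^ x              ≡⟨ ℤ.neg-involutive (-1ℤ ℤ.^ x) ⟨
      - - (-1ℤ ℤ.^ x)        ≡⟨ cong -_ (-1^suc x) ⟨
      - (-1ℤ ℤ.^ suc x)
        ≡⟨ cong (λ k → - (-1ℤ ℤ.^ k)) (wexx-swap-descent {a = suc b} {a} {r} perm (s≤s a<b)) ⟨
      - (-1ℤ ℤ.^ y)          ∎
    ... | tri≈ _ a≡b _ = contradiction (perm {zero} {suc zero} (cong suc (sym a≡b))) λ ()
    ... | tri> _ _ b<a =
      trans (cong (-1ℤ ℤ.^_) (wexx-swap-descent {a = suc a} {b} {r} (from IsPerm-swap01 perm) (s≤s b<a)))
            (-1^suc y)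

module _ {f : Fin n → Fin n} {g : Fin (suc n) → Fin (suc n)}
         (g0 : g zero ≡ zero) (gs : ∀ i → g (suc i) ≡ suc (f i)) where

  private
    lower-< : ∀ {x y} → g (suc x) Fin.< g (suc y) → f x Fin.< f y
    lower-< {x} {y} = ℕ.s<s⁻¹ ∘ subst₂ Fin._<_ (gs x) (gs y)

    raise-< : ∀ {x y} → f x Fin.< f y → g (suc x) Fin.< g (suc y)
    raise-< {x} {y} = subst₂ Fin._<_ (sym (gs x)) (sym (gs y)) ∘ ℕ.s<s

  IsWexx-lift : ∀ j → IsWexx g (suc j) ⇔ IsWexx f j
  IsWexx-lift j = mk⇔ lower raise
    where
    lower : IsWexx g (suc j) → IsWexx f j
    lower (_ , zero , _ , _ , _ , gj<g0 , _) = contradiction (subst (g (suc j) Fin.<_) g0 gj<g0) λ ()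
    lower (_ , suc i , zero , _ , () , _)
    lower (j≤gj , suc i , suc k , i<j , j<k , gj<gi , gk<gj) =
      ℕ.s≤s⁻¹ (subst (suc j Fin.≤_) (gs j) j≤gj) , i , k ,
      ℕ.s<s⁻¹ i<j , ℕ.s<s⁻¹ j<k , lower-< gj<gi , lower-< gk<gj
    raise : IsWexx f j → IsWexx g (suc j)
    raise (j≤fj , i , k , i<j , j<k , fj<fi , fk<fj) =
      subst (suc j Fin.≤_) (sym (gs j)) (s≤s j≤fj) , suc i , suc k ,
      ℕ.s<s i<j , ℕ.s<s j<k , raise-< fj<fi , raise-< fk<fj

  wexx-lift : wexxF g ≡ wexxF f
  wexx-lift = cong₂ _+_ (cong ⟦_⟧ (¬T⇒≡false (¬IsWexx-zero ∘ to (wexxAt⇔IsWexx {f = g} {j = zero}))))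
                        (count-cong (λ j → T-injective (⇔.trans (wexxAt⇔IsWexx {f = g})
                                      (⇔.trans (IsWexx-lift j) (⇔.sym (wexxAt⇔IsWexx {f = f}))))))

wexx-doubling : ∀ m → signedSum wexxF (2 + m) ≡ signedSum wexxF (1 + m) ℤ.+ signedSum wexxF (1 + m)
wexx-doubling m = begin
  ∑ⱽ (2 + m) w
    ≡⟨⟩
  Z ℤ.+ ∑[ a < 1 + m ] (B (suc a) zero ℤ.+ ∑[ b < 1 + m ] B (suc a) (suc b))
    ≡⟨ cong (ℤ._+_ Z) (∑-distrib-+ (λ a → B (suc a) zero) (λ a → ∑[ b < 1 + m ] B (suc a) (suc b))) ⟩
  Z ℤ.+ (∑[ a < 1 + m ] B (suc a) zero ℤ.+ ∑[ a < 1 + m ] ∑[ b < 1 + m ] B (suc a) (suc b))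
    ≡⟨ cong₂ (λ x y → Z ℤ.+ (x ℤ.+ y))
             (sum-cong-≗ (λ a → ∑ⱽ-cong m (λ r → weight-wexx-swap-zero {r = r} -1ℤ {suc a})))
             (∑∑-antisymmetric (λ a b → B (suc a) (suc b)) antisymmetric) ⟩
  Z ℤ.+ (∑[ a < 1 + m ] B zero (suc a) ℤ.+ + 0)
    ≡⟨ cong (ℤ._+_ Z) (ℤ.+-identityʳ _) ⟩
  Z ℤ.+ ∑[ a < 1 + m ] B zero (suc a)
    ≡⟨ cong (ℤ._+_ Z) (ℤ.+-identityˡ _) ⟨
  Z ℤ.+ (+ 0 ℤ.+ ∑[ a < 1 + m ] B zero (suc a))
    ≡⟨ cong (λ x → Z ℤ.+ (x ℤ.+ ∑[ a < 1 + m ] B zero (suc a))) B₀₀≡0 ⟨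
  Z ℤ.+ Z
    ≡⟨ cong₂ ℤ._+_ Z≡S Z≡S ⟩
  signedSum wexxF (1 + m) ℤ.+ signedSum wexxF (1 + m) ∎
  where
  open ≡-Reasoning
  w : Vec (Fin (2 + m)) (2 + m) → ℤ
  w = weight wexxF -1ℤ
  B : Fin (2 + m) → Fin (2 + m) → ℤ
  B a b = ∑ⱽ m (λ r → w (a ∷ b ∷ r))
  Z : ℤ
  Z = ∑ⱽ (1 + m) (λ r → w (zero ∷ r))
  Z≡S : Z ≡ signedSum wexxF (1 + m)
  Z≡S = ∑ⱽ-weight-fixing-zero {1 + m} wexxF -1ℤ λ u _ →
    wexx-lift {f = lookup u} {g = lookup (zero ∷ Vec.map suc u)} refl (λ i → Vec.lookup-map i suc u)
  B₀₀≡0 : B zero zero ≡ + 0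
  B₀₀≡0 = ∑ⱽ-zero m λ r →
    weight-nonperm wexxF -1ℤ {v = zero ∷ zero ∷ r} (λ inj → case inj {zero} {suc zero} refl of λ ())
  antisymmetric : ∀ a b → B (suc a) (suc b) ≡ - B (suc b) (suc a)
  antisymmetric a b = trans (∑ⱽ-cong m (λ r → weight-wexx-swap-suc {r = r} {a} {b}))
                            (∑ⱽ-neg m (λ r → w (suc b ∷ suc a ∷ r)))

-- The statistic cdes

IsCycleMinimum : (Fin n → Fin n) → Fin n → Set
IsCycleMinimum f x = ∀ k → x Fin.≤ fold x f k

cycleMinᵇ : (Fin n → Fin n) → Fin n → Bool
cycleMinᵇ {n} f x = all (λ k → ⌊ x Fin.≤? fold x f k ⌋) (upTo n)

cdesAt : (Fin n → Fin n) → Fin n → Bool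
cdesAt f i = ⌊ f i Fin.<? i ⌋ ∧ not (cycleMinᵇ f (f i))

cdesF : (Fin n → Fin n) → ℕ
cdesF f = count (cdesAt f)

iter≡fold : (σ : Perm n) (k : ℕ) (x : Fin n) → iter σ k x ≡ fold x (app σ) k
iter≡fold σ zero    x = refl
iter≡fold σ (suc k) x = cong (app σ) (iter≡fold σ k x)

cdes≡cdesF : (σ : Perm n) → cdes σ ≡ cdesF (app σ)
cdes≡cdesF {n} σ = trans (countB-tabulate descentᵇ (λ i → i)) (count-cong same-at)
  where
  descentᵇ : Fin n → Bool
  descentᵇ i = ⌊ app σ i Fin.<? i ⌋ ∧ not (isCycleMin σ (app σ i))
  same-at : ∀ i → descentᵇ i ≡ cdesAt (app σ) i
  same-at i = cong (λ b → ⌊ app σ i Fin.<? i ⌋ ∧ not (and b)) (map-cong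
    (λ k → cong (λ y → ⌊ app σ i Fin.≤? y ⌋) (iter≡fold σ k (app σ i))) (upTo n))

cycleMinᵇ⇔IsCycleMinimum : {f : Fin n → Fin n} → Injective _≡_ _≡_ f → {x : Fin n} →
                           T (cycleMinᵇ f x) ⇔ IsCycleMinimum f x
cycleMinᵇ⇔IsCycleMinimum {n} {f} f-injective {x} = mk⇔
  (λ t k → let j , j<n , fk≡fj = fold-below f-injective x k
           in subst (x Fin.≤_) (sym fk≡fj) (toWitness (to (T-all-upTo {n} {p}) t j j<n)))
  (λ min → from (T-all-upTo {n} {p}) (λ k _ → fromWitness (min k)))
  where
  p : ℕ → Bool
  p k = ⌊ x Fin.≤? fold x f k ⌋

cycleMinᵇ-zero : (f : Fin (suc n) → Fin (suc n)) → cycleMinᵇ f zero ≡ true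
cycleMinᵇ-zero {n} f =
  to T-≡ (from (T-all-upTo {suc n} {λ k → ⌊ zero {n} Fin.≤? fold zero f k ⌋}) (λ _ _ → tt))

cdesAt-zero-value : {f : Fin (suc n) → Fin (suc n)} {i : Fin (suc n)} →
                    f i ≡ zero → cdesAt f i ≡ false
cdesAt-zero-value {f = f} {i} fi≡0 = ¬T⇒≡false λ t →
  subst (T ∘ not) (trans (cong (cycleMinᵇ f) fi≡0) (cycleMinᵇ-zero f))
                  (proj₂ (to (T-⌊⌋∧ (f i Fin.<? i)) t))

cycleMinimum-one⇔unreachable : {f : Fin (suc (suc n)) → Fin (suc (suc n))} →
                                IsCycleMinimum f (suc zero) ⇔ (¬ Reaches f (suc zero) zero)
cycleMinimum-one⇔unreachable {n} {f} = mk⇔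
  (λ min (k , fk≡0) → case ℕ.≤-trans (min k) (ℕ.≤-reflexive (cong toℕ fk≡0)) of λ ())
  (λ unreachable k → nonzero (fold (suc zero) f k) (unreachable ∘ (k ,_)))
  where
  nonzero : (y : Fin (suc (suc n))) → y ≢ zero → 1 ℕ.≤ toℕ y
  nonzero zero    y≢0 = contradiction refl y≢0
  nonzero (suc _) _   = s≤s z≤n

transposed-swap01 : {f g : Fin (suc (suc n)) → Fin (suc (suc n))} → (∀ i → g i ≡ swap01 (f i)) →
                    Transposed (suc zero) zero f g
transposed-swap01 {f = f} g≗swap01∘f = record
  { x↦y   = λ {z} fz≡1 → trans (g≗swap01∘f z) (cong swap01 fz≡1)
  ; y↦x   = λ {z} fz≡0 → trans (g≗swap01∘f z) (cong swap01 fz≡0)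
  ; fixes = λ {z} fz≢1 fz≢0 → trans (g≗swap01∘f z) (swap01-fixes (f z) fz≢0 fz≢1)
  }

cycleMinimum-transfer : {f g : Fin (suc (suc n)) → Fin (suc (suc n))} → Transposed (suc zero) zero f g →
                        ∀ w → IsCycleMinimum f (suc (suc w)) → IsCycleMinimum g (suc (suc w))
cycleMinimum-transfer {f = f} {g} fg w min k = subst (suc (suc w) Fin.≤_) (sym agrees) (min k)
  where
  avoids : ∀ j → j ℕ.< k →
           fold (suc (suc w)) f (suc j) ≢ suc zero × fold (suc (suc w)) f (suc j) ≢ zero
  avoids j _ = (λ e → case ℕ.≤-trans (min (suc j)) (ℕ.≤-reflexive (cong toℕ e)) of λ { (s≤s ()) })
             , (λ e → case ℕ.≤-trans (min (suc j)) (ℕ.≤-reflexive (cong toℕ e)) of λ ())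
  agrees : fold (suc (suc w)) g k ≡ fold (suc (suc w)) f k
  agrees = orbit-prefix-agrees fg k avoids k ℕ.≤-refl

one≮⇒≡one : (y p : Fin (suc (suc n))) → y ≡ suc zero → p ≢ zero → ⌊ y Fin.<? p ⌋ ≡ false → p ≡ y
one≮⇒≡one _ zero          refl p≢0 _  = contradiction refl p≢0
one≮⇒≡one _ (suc zero)    refl _   _  = refl
one≮⇒≡one _ (suc (suc p)) refl _   ()

module ValueSwap {f g : Fin (suc (suc n)) → Fin (suc (suc n))}
                 (f-injective : Injective _≡_ _≡_ f) (g≗swap01∘f : ∀ i → g i ≡ swap01 (f i)) where

  f≗swap01∘g : ∀ i → f i ≡ swap01 (g i)
  f≗swap01∘g i = trans (sym (swap01-involutive (f i))) (cong swap01 (sym (g≗swap01∘f i)))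

  g-injective : Injective _≡_ _≡_ g
  g-injective {i} {j} gi≡gj =
    f-injective (trans (f≗swap01∘g i) (trans (cong swap01 gi≡gj) (sym (f≗swap01∘g j))))

  cycleMinᵇ-large : ∀ y → y ≢ zero → y ≢ suc zero → cycleMinᵇ g y ≡ cycleMinᵇ f y
  cycleMinᵇ-large zero          y≢0 _   = contradiction refl y≢0
  cycleMinᵇ-large (suc zero)    _   y≢1 = contradiction refl y≢1
  cycleMinᵇ-large (suc (suc w)) _   _   = T-injective
    (⇔.trans (cycleMinᵇ⇔IsCycleMinimum g-injective) (⇔.trans
      (mk⇔ (cycleMinimum-transfer (transposed-swap01 f≗swap01∘g) w)
           (cycleMinimum-transfer (transposed-swap01 g≗swap01∘f) w))
      (⇔.sym (cycleMinᵇ⇔IsCycleMinimum f-injective))))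

  cycleMinᵇ-one : cycleMinᵇ g (suc zero) ≡ not (cycleMinᵇ f (suc zero))
  cycleMinᵇ-one = ≡not-by-exclusion
    (⇔.trans (cycleMinᵇ⇔IsCycleMinimum f-injective) cycleMinimum-one⇔unreachable)
    (⇔.trans (cycleMinᵇ⇔IsCycleMinimum g-injective) cycleMinimum-one⇔unreachable)
    (reaches-exclusive fg λ ())
    (reaches-exhaustive fg f-injective)
    where fg = transposed-swap01 g≗swap01∘f

  cdesAt-large : ∀ i → f i ≢ zero → f i ≢ suc zero → cdesAt g i ≡ cdesAt f i
  cdesAt-large i fi≢0 fi≢1 = begin
    cdesAt g i
      ≡⟨ cong (λ z → ⌊ z Fin.<? i ⌋ ∧ not (cycleMinᵇ g z)) gi≡fi ⟩
    ⌊ f i Fin.<? i ⌋ ∧ not (cycleMinᵇ g (f i))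
      ≡⟨ cong (λ b → ⌊ f i Fin.<? i ⌋ ∧ not b) (cycleMinᵇ-large (f i) fi≢0 fi≢1) ⟩
    cdesAt f i
      ∎
    where
    open ≡-Reasoning
    gi≡fi : g i ≡ f i
    gi≡fi = trans (g≗swap01∘f i) (swap01-fixes (f i) fi≢0 fi≢1)

  -- The positions of the values 0 and 1, the only places where cdesAt f and cdesAt g can differ.
  p₀ p₁ : Fin (suc (suc n))
  p₀ = proj₁ (injective⇒surjective f-injective zero)
  p₁ = proj₁ (injective⇒surjective f-injective (suc zero))

  fp₀ : f p₀ ≡ zero
  fp₀ = proj₂ (injective⇒surjective f-injective zero)

  fp₁ : f p₁ ≡ suc zero
  fp₁ = proj₂ (injective⇒surjective f-injective (suc zero))

  gp₀ : g p₀ ≡ suc zero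
  gp₀ = trans (g≗swap01∘f p₀) (cong swap01 fp₀)

  p₀≢p₁ : p₀ ≢ p₁
  p₀≢p₁ p₀≡p₁ = case trans (sym fp₀) (trans (cong f p₀≡p₁) fp₁) of λ ()

  cdes-swap : cdesF f + ⟦ cdesAt g p₀ ⟧ ≡ cdesF g + ⟦ cdesAt f p₁ ⟧
  cdes-swap = begin
    cdesF f + ⟦ cdesAt g p₀ ⟧                    ≡⟨ ℕ.+-identityʳ _ ⟨
    cdesF f + ⟦ cdesAt g p₀ ⟧ + 0                ≡⟨ cong (λ b → cdesF f + ⟦ cdesAt g p₀ ⟧ + ⟦ b ⟧) g-at-p₁ ⟨
    cdesF f + ⟦ cdesAt g p₀ ⟧ + ⟦ cdesAt g p₁ ⟧  ≡⟨ count-except₂ p₀≢p₁ agree ⟩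
    cdesF g + ⟦ cdesAt f p₀ ⟧ + ⟦ cdesAt f p₁ ⟧  ≡⟨ cong (λ b → cdesF g + ⟦ b ⟧ + ⟦ cdesAt f p₁ ⟧) f-at-p₀ ⟩
    cdesF g + 0 + ⟦ cdesAt f p₁ ⟧                ≡⟨ cong (_+ ⟦ cdesAt f p₁ ⟧) (ℕ.+-identityʳ _) ⟩
    cdesF g + ⟦ cdesAt f p₁ ⟧                    ∎
    where
    open ≡-Reasoning
    f-at-p₀ : cdesAt f p₀ ≡ false
    f-at-p₀ = cdesAt-zero-value {f = f} {p₀} fp₀
    g-at-p₁ : cdesAt g p₁ ≡ false
    g-at-p₁ = cdesAt-zero-value {f = g} {p₁} (trans (g≗swap01∘f p₁) (cong swap01 fp₁))
    agree : ∀ i → i ≢ p₀ → i ≢ p₁ → cdesAt f i ≡ cdesAt g i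
    agree i i≢p₀ i≢p₁ = sym (cdesAt-large i (i≢p₀ ∘ f-injective ∘ flip trans (sym fp₀))
                                             (i≢p₁ ∘ f-injective ∘ flip trans (sym fp₁)))

  cdes-swap-fixed : f zero ≡ zero → cdesF g ≡ cdesF f
  cdes-swap-fixed f0≡0 = sym (ℕ.+-cancelʳ-≡ 0 (cdesF f) (cdesF g) (begin
    cdesF f + 0                  ≡⟨ cong (λ b → cdesF f + ⟦ b ⟧) g-at-p₀ ⟨
    cdesF f + ⟦ cdesAt g p₀ ⟧    ≡⟨ cdes-swap ⟩
    cdesF g + ⟦ cdesAt f p₁ ⟧    ≡⟨ cong (λ b → cdesF g + ⟦ b ⟧) f-at-p₁ ⟩
    cdesF g + 0                  ∎))
    where
    open ≡-Reasoning
    p₀≡0 : p₀ ≡ zero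
    p₀≡0 = f-injective (trans fp₀ (sym f0≡0))
    g-at-p₀ : cdesAt g p₀ ≡ false
    g-at-p₀ = ¬T⇒≡false λ t →
      case ℕ.≤-trans (proj₁ (to (T-⌊⌋∧ (g p₀ Fin.<? p₀)) t)) (ℕ.≤-reflexive (cong toℕ p₀≡0))
      of λ ()
    orbit-of-zero : ∀ k → fold zero f k ≡ zero
    orbit-of-zero zero    = refl
    orbit-of-zero (suc k) = trans (cong f (orbit-of-zero k)) f0≡0
    one-minimal : cycleMinᵇ f (suc zero) ≡ true
    one-minimal = to T-≡ (from (cycleMinᵇ⇔IsCycleMinimum f-injective) (from cycleMinimum-one⇔unreachable
      λ (k , fk≡0) → case fold-injective f-injective k (trans fk≡0 (sym (orbit-of-zero k))) of λ ()))
    f-at-p₁ : cdesAt f p₁ ≡ false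
    f-at-p₁ = ¬T⇒≡false λ t →
      subst (T ∘ not) (trans (cong (cycleMinᵇ f) fp₁) one-minimal)
                      (proj₂ (to (T-⌊⌋∧ (f p₁ Fin.<? p₁)) t))

  cdes-swap-moved : f zero ≢ zero → f zero ≢ suc zero → cdesAt g p₀ ≡ not (cdesAt f p₁)
  cdes-swap-moved f0≢0 f0≢1 = begin
    cdesAt g p₀
      ≡⟨ cong (λ z → ⌊ g p₀ Fin.<? p₀ ⌋ ∧ not (cycleMinᵇ g z)) gp₀ ⟩
    ⌊ g p₀ Fin.<? p₀ ⌋ ∧ not (cycleMinᵇ g (suc zero))
      ≡⟨ cong (λ b → ⌊ g p₀ Fin.<? p₀ ⌋ ∧ not b) cycleMinᵇ-one ⟩
    ⌊ g p₀ Fin.<? p₀ ⌋ ∧ not (not c)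
      ≡⟨ cong (⌊ g p₀ Fin.<? p₀ ⌋ ∧_) (not-involutive c) ⟩
    ⌊ g p₀ Fin.<? p₀ ⌋ ∧ c
      ≡⟨ ∧-not-∧ _ _ c p₀-one p₁-one (λ e₀ e₁ → p₀≢p₁ (trans (p₀≡1 e₀) (sym (p₁≡1 e₁)))) ⟩
    not (⌊ f p₁ Fin.<? p₁ ⌋ ∧ not c)
      ≡⟨ cong (λ z → not (⌊ f p₁ Fin.<? p₁ ⌋ ∧ not (cycleMinᵇ f z))) fp₁ ⟨
    not (cdesAt f p₁)
      ∎
    where
    open ≡-Reasoning
    c : Bool
    c = cycleMinᵇ f (suc zero)
    p₀≡1 : ⌊ g p₀ Fin.<? p₀ ⌋ ≡ false → p₀ ≡ suc zero
    p₀≡1 e = trans (one≮⇒≡one (g p₀) p₀ gp₀ (λ p₀≡0 → f0≢0 (subst (λ p → f p ≡ zero) p₀≡0 fp₀)) e) gp₀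
    p₁≡1 : ⌊ f p₁ Fin.<? p₁ ⌋ ≡ false → p₁ ≡ suc zero
    p₁≡1 e = trans (one≮⇒≡one (f p₁) p₁ fp₁ (λ p₁≡0 → f0≢1 (subst (λ p → f p ≡ suc zero) p₁≡0 fp₁)) e) fp₁
    p₀-one : ⌊ g p₀ Fin.<? p₀ ⌋ ≡ false → c ≡ false
    p₀-one e = ¬T⇒≡false λ t →
      to cycleMinimum-one⇔unreachable (to (cycleMinᵇ⇔IsCycleMinimum f-injective) t)
        (1 , trans (cong f (sym (p₀≡1 e))) fp₀)
    p₁-one : ⌊ f p₁ Fin.<? p₁ ⌋ ≡ false → c ≡ true
    p₁-one e = to T-≡ (from (cycleMinᵇ⇔IsCycleMinimum f-injective)
                           (λ k → ℕ.≤-reflexive (cong toℕ (sym (fixed k)))))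
      where
      fixed : ∀ k → fold (suc zero) f k ≡ suc zero
      fixed zero    = refl
      fixed (suc k) = trans (cong f (fixed k)) (trans (cong f (sym (p₁≡1 e))) fp₁)

module _ {f : Fin n → Fin n} {g : Fin (suc n) → Fin (suc n)}
         (f-injective : Injective _≡_ _≡_ f) (g-injective : Injective _≡_ _≡_ g)
         (g0 : g zero ≡ zero) (gs : ∀ i → g (suc i) ≡ suc (f i)) where

  fold-lift : ∀ w k → fold (suc w) g k ≡ suc (fold w f k)
  fold-lift w zero    = refl
  fold-lift w (suc k) = trans (cong g (fold-lift w k)) (gs (fold w f k))

  cycleMinᵇ-lift : ∀ w → cycleMinᵇ g (suc w) ≡ cycleMinᵇ f w
  cycleMinᵇ-lift w = T-injective (⇔.trans (cycleMinᵇ⇔IsCycleMinimum g-injective) (⇔.trans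
    (mk⇔ (λ min k → ℕ.s≤s⁻¹ (subst (suc w Fin.≤_) (fold-lift w k) (min k)))
         (λ min k → subst (suc w Fin.≤_) (sym (fold-lift w k)) (s≤s (min k))))
    (⇔.sym (cycleMinᵇ⇔IsCycleMinimum f-injective))))

  cdes-lift : cdesF g ≡ cdesF f
  cdes-lift = cong₂ _+_ (cong ⟦_⟧ (cdesAt-zero-value {f = g} {zero} g0)) (count-cong lowered)
    where
    <?-suc : ∀ {x y : Fin n} → ⌊ suc x Fin.<? suc y ⌋ ≡ ⌊ x Fin.<? y ⌋
    <?-suc = T-injective (mk⇔ (fromWitness ∘ ℕ.s<s⁻¹ ∘ toWitness) (fromWitness ∘ ℕ.s<s ∘ toWitness))
    lowered : ∀ i → cdesAt g (suc i) ≡ cdesAt f i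
    lowered i = trans (cong (λ z → ⌊ z Fin.<? suc i ⌋ ∧ not (cycleMinᵇ g z)) (gs i))
                      (cong₂ (λ a b → a ∧ not b) <?-suc (cycleMinᵇ-lift (f i)))

IsPerm-map-swap01 : {v : Vec (Fin (suc (suc n))) (suc (suc n))} → IsPerm (Vec.map swap01 v) ⇔ IsPerm v
IsPerm-map-swap01 {v = v} = mk⇔
  (λ inj {i} {j} vi≡vj → inj (trans (lookup-swap i) (trans (cong swap01 vi≡vj) (sym (lookup-swap j)))))
  (λ inj {i} {j} e → inj (swap01-injective (trans (sym (lookup-swap i)) (trans e (lookup-swap j)))))
  where
  lookup-swap : ∀ i → lookup (Vec.map swap01 v) i ≡ swap01 (lookup v i)
  lookup-swap i = Vec.lookup-map i swap01 v
  swap01-injective : ∀ {x y} → swap01 x ≡ swap01 y → x ≡ y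
  swap01-injective {x} {y} e = trans (sym (swap01-involutive x)) (trans (cong swap01 e) (swap01-involutive y))

module _ {r : Vec (Fin (suc (suc m))) (suc m)} where

  weight-cdes-swap-fixed : weight cdesF -1ℤ (Vec.map swap01 (zero ∷ r)) ≡ weight cdesF -1ℤ (zero ∷ r)
  weight-cdes-swap-fixed =
    weight-transfer cdesF -1ℤ {v = Vec.map swap01 (zero ∷ r)} {w = zero ∷ r} (λ z → z) refl
      (IsPerm-map-swap01 {v = zero ∷ r})
      (λ perm → cong (-1ℤ ℤ.^_)
                     (ValueSwap.cdes-swap-fixed perm (λ i → Vec.lookup-map i swap01 (zero ∷ r)) refl))

  weight-cdes-swap-moved : {a : Fin m} →
                           weight cdesF -1ℤ (Vec.map swap01 (suc (suc a) ∷ r)) ≡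
                           - weight cdesF -1ℤ (suc (suc a) ∷ r)
  weight-cdes-swap-moved {a} =
    weight-transfer cdesF -1ℤ {v = Vec.map swap01 v} {w = v} -_ refl (IsPerm-map-swap01 {v = v}) flips
    where
    v : Vec (Fin (suc (suc m))) (suc (suc m))
    v = suc (suc a) ∷ r
    flips : IsPerm v → -1ℤ ℤ.^ cdesF (lookup (Vec.map swap01 v)) ≡ - (-1ℤ ℤ.^ cdesF (lookup v))
    flips perm = -1^-flip _ _ (cdesAt (lookup v) p₁)
      (subst (λ b → cdesF (lookup v) + ⟦ b ⟧ ≡ cdesF (lookup (Vec.map swap01 v)) + ⟦ cdesAt (lookup v) p₁ ⟧)
             (cdes-swap-moved (λ ()) (λ ())) cdes-swap)
      where open ValueSwap perm (λ i → Vec.lookup-map i swap01 v)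

cdes-doubling : ∀ m → signedSum cdesF (2 + m) ≡ signedSum cdesF (1 + m) ℤ.+ signedSum cdesF (1 + m)
cdes-doubling m = begin
  ∑ⱽ (2 + m) w                                     ≡⟨⟩
  U zero ℤ.+ (U (suc zero) ℤ.+ ∑[ a < m ] U (suc (suc a)))
    ≡⟨ cong₂ (λ x y → U zero ℤ.+ (x ℤ.+ y)) U₁≡U₀
             (trans (sum-cong-≗ U-moved) (sum-replicate-zero m)) ⟩
  U zero ℤ.+ (U zero ℤ.+ + 0)                      ≡⟨ cong (ℤ._+_ (U zero)) (ℤ.+-identityʳ (U zero)) ⟩
  U zero ℤ.+ U zero                                ≡⟨ cong₂ ℤ._+_ U₀≡S U₀≡S ⟩
  signedSum cdesF (1 + m) ℤ.+ signedSum cdesF (1 + m) ∎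
  where
  open ≡-Reasoning
  w : Vec (Fin (2 + m)) (2 + m) → ℤ
  w = weight cdesF -1ℤ
  U : Fin (2 + m) → ℤ
  U a = ∑ⱽ (1 + m) (λ r → w (a ∷ r))
  U₀≡S : U zero ≡ signedSum cdesF (1 + m)
  U₀≡S = ∑ⱽ-weight-fixing-zero {1 + m} cdesF -1ℤ
    (λ u perm → cdes-lift {f = lookup u} {g = lookup (zero ∷ Vec.map suc u)}
                  perm (from IsPerm-lift perm) refl (λ i → Vec.lookup-map i suc u))
  U₁≡U₀ : U (suc zero) ≡ U zero
  U₁≡U₀ = trans (sym (∑ⱽ-map swap01 ∑-swap01 (1 + m) (λ r → w (suc zero ∷ r))))
                (∑ⱽ-cong (1 + m) (λ r → weight-cdes-swap-fixed {r = r}))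
  U-moved : ∀ a → U (suc (suc a)) ≡ + 0
  U-moved a = ∑ⱽ-sign-reversing swap01 ∑-swap01 (1 + m) (λ r → w (suc (suc a) ∷ r))
                (λ r → weight-cdes-swap-moved {r = r})

signedSum-wexx : ∀ n → signedSum wexxF n ≡ + a n
signedSum-wexx = doubling⇒a (signedSum wexxF) refl refl wexx-doubling

signedSum-cdes : ∀ n → signedSum cdesF n ≡ + a n
signedSum-cdes = doubling⇒a (signedSum cdesF) refl refl cdes-doubling

corollary3p10 : ExhibitsCSP wexx × ExhibitsCSP cdes
corollary3p10 =
  csp-from-signed-sums wexx wexxF wexx≡wexxF signedSum-wexx ,
  csp-from-signed-sums cdes cdesF cdes≡cdesF signedSum-cdes
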